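{- Let $\ell\ge 3$ and $r\ge 3$ be integers such that the generalised H-graph $H^\ell(r)$ satisfies $\chi_\rho(H^\ell(r))\le 5$, and let $\pi$ be a packing $5$-colouring of $H^\ell(r)$. Then for every $j$ with $0\le j\le 2r-1$, $\pi$ assigns colour $1$ to one endpoint of the edge $u^0_ju^0_{j+1}$ and to one endpoint of the edge $u^{\ell+1}_ju^{\ell+1}_{j+1}$ (subscripts modulo $2r$).
   Context: All graphs are simple; $d_G(u,v)$ is the shortest-path distance. A packing $k$-colouring of $G$ is a map $\pi:V(G)\to\{1,\dots,k\}$ such that for distinct $u,v$, $\pi(u)=\pi(v)=i$ implies $d_G(u,v)>i$; $\chi_\rho(G)$ is the least $k$ for which a packing $k$-colouring exists. For integers $r\ge 2$ and $\ell\ge 1$, the generalised H-graph $H^\ell(r)$ has vertex set $\{u^i_j: 0\le i\le \ell+1,\ 0\le j\le 2r-1\}$ and edge set consisting of: $u^0_ju^0_{j+1}$ and $u^{\ell+1}_ju^{\ell+1}_{j+1}$ for $0\le j\le 2r-1$ (subscripts modulo $2r$); $u^i_{2j}u^i_{2j+1}$ for $1\le i\le \ell$, $0\le j\le r-1$; and $u^i_ju^{i+1}_j$ for $0\le i\le \ell$, $0\le j\le 2r-1$. -}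

module Defs where

open import Data.Nat using (ℕ; zero; suc; _+_; _*_; _≤_; _<_)
open import Data.Fin using (Fin; toℕ)
open import Data.Product using (_×_; _,_; Σ; ∃)
open import Data.Sum using (_⊎_)
open import Relation.Binary.PropositionalEquality using (_≡_; _≢_)
open import Relation.Nullary using (¬_)

record Graph : Set₁ where
  field
    V   : Set
    Adj : V → V → Set

open Graph public

data Walk (G : Graph) : V G → V G → ℕ → Set where
  here : ∀ {u} → Walk G u u zero
  step : ∀ {u w v n} → Adj G u w → Walk G w v n → Walk G u v (suc n)

-- d_G(u,v) ≤ i  (there is a u–v walk, equivalently path, of length ≤ i).
-- Vertices in different components have infinite distance, so never satisfy this.
DistLe : (G : Graph) → V G → V G → ℕ → Set
DistLe G u v i = Σ ℕ λ n → n ≤ i × Walk G u v n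

IsPackingColouring : (G : Graph) → ℕ → (V G → ℕ) → Set
IsPackingColouring G k π =
  (∀ v → 1 ≤ π v × π v ≤ k) ×
  (∀ u v → u ≢ v → π u ≡ π v → ¬ DistLe G u v (π u))

-- Generalised H-graph H^ℓ(r).
-- Vertex u^i_j is the pair (i , j), with i ∈ {0,…,ℓ+1}, j ∈ {0,…,2r-1}.

HV : ℕ → ℕ → Set
HV ℓ r = Fin (suc (suc ℓ)) × Fin (2 * r)

CycSucc : (n : ℕ) → Fin n → Fin n → Set
CycSucc n j j' = suc (toℕ j) ≡ toℕ j' ⊎ (suc (toℕ j) ≡ n × toℕ j' ≡ 0)

data HEdge (ℓ r : ℕ) : HV ℓ r → HV ℓ r → Set where
  outer : ∀ i j j' → (toℕ i ≡ 0 ⊎ toℕ i ≡ suc ℓ) → CycSucc (2 * r) j j' →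
          HEdge ℓ r (i , j) (i , j')
  rung  : ∀ i j j' k → 1 ≤ toℕ i → toℕ i ≤ ℓ →
          toℕ j ≡ 2 * k → toℕ j' ≡ suc (toℕ j) →
          HEdge ℓ r (i , j) (i , j')
  vert  : ∀ i i' j → toℕ i' ≡ suc (toℕ i) →
          HEdge ℓ r (i , j) (i' , j)

H : ℕ → ℕ → Graph
H ℓ r = record { V = HV ℓ r ; Adj = λ x y → HEdge ℓ r x y ⊎ HEdge ℓ r y x }

ChiRhoLe : Graph → ℕ → Set
ChiRhoLe G k = ∃ λ π → IsPackingColouring G k π

module Submission where

-- In a packing 5-colouring of H^ℓ(r) consider four consecutive layers, starting at one of the
-- rings, over three consecutive rung blocks. An exhaustive search shows that every packing
-- 5-colouring of this window gives colour 1 to an outer vertex of its middle block, so every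
-- ring edge u_{2k} u_{2k+1} meets colour 1. Colour 1 is independent, so if neither end of an
-- edge u_{2k+1} u_{2k+2} had colour 1, colour 1 would be forced onto u_{2k+3}, u_{2k+5}, ...
-- and all the way round the ring back onto u_{2k+1}. The second ring is handled by the
-- reflection of H^ℓ(r) that swaps the two rings.

open import Defs
open import Data.Bool using (Bool; true; false; T; not; _∧_)
open import Data.Bool.ListAction using (all; any)
open import Data.Bool.Properties using (T-∧)
open import Data.Empty using (⊥-elim)
open import Data.Fin using (Fin; toℕ; zero; fromℕ; opposite; inject≤) renaming (suc to fsuc)
open import Data.Fin.Patterns using (0F; 1F; 2F; 3F; 4F; 5F)
open import Data.Fin.Properties as Fin
  using (toℕ<n; toℕ-fromℕ<; toℕ-injective; toℕ-inject≤; inject≤-injective; opposite-prop; opposite-involutive)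
open import Data.List using (List; []; _∷_; _++_; map; foldr)
open import Data.List.Membership.Propositional using (_∈_)
open import Data.List.Relation.Unary.All as All using (All; []; _∷_)
open import Data.List.Relation.Unary.All.Properties as All using ()
open import Data.List.Relation.Unary.Any as Any using (here; there)
open import Data.List.Relation.Unary.Any.Properties as Any using ()
open import Data.Maybe as Maybe using (Maybe; just; nothing; is-just; _<∣>_)
open import Data.Nat
  using (ℕ; zero; suc; _+_; _*_; _∸_; _≤_; _<_; _≡ᵇ_; z≤n; s≤s; z<s; NonZero; >-nonZero⁻¹; _<?_)
open import Data.Nat.DivMod
  using (_%_; _/_; _mod_; m%n<n; m<n⇒m%n≡m; m≡m%n+[m/n]*n; [m+kn]%n≡m%n; [m+n]%n≡m%n; n%n≡0; %-distribˡ-+)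
open import Data.Nat.Properties
open import Data.Nat.Tactic.RingSolver using (solve-∀)
open import Data.Product using (Σ; ∃-syntax; _×_; _,_; proj₁; proj₂)
open import Data.Product.Properties using (≡-dec; ,-injective; ×-≡,≡→≡)
open import Data.Sum as Sum using (_⊎_; inj₁; inj₂; [_,_]′; swap)
open import Data.Unit using (tt)
open import Function using (_∘_; id; Equivalence)
open import Function.Definitions using (Injective)
open import Relation.Binary.Definitions using (DecidableEquality; tri<; tri≈; tri>)
open import Relation.Binary.PropositionalEquality
  using (_≡_; _≢_; refl; sym; trans; cong; subst; module ≡-Reasoning)
open import Relation.Nullary using (¬_; yes; no)
open import Relation.Unary using (Decidable)

Homomorphism : (G G′ : Graph) → (V G → V G′) → Set
Homomorphism G G′ f = ∀ {u v} → Adj G u v → Adj G′ (f u) (f v)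

module _ {G G′ : Graph} {f : V G → V G′} (f-hom : Homomorphism G G′ f) where

  map-walk : ∀ {u v n} → Walk G u v n → Walk G′ (f u) (f v) n
  map-walk here       = here
  map-walk (step e w) = step (f-hom e) (map-walk w)

  packing-pullback : Injective _≡_ _≡_ f → ∀ {k π} → IsPackingColouring G′ k π → IsPackingColouring G k (π ∘ f)
  packing-pullback f-injective (bounded , packed) =
    (λ v → bounded (f v)) ,
    (λ u v u≢v same (n , n≤ , w) → packed (f u) (f v) (u≢v ∘ f-injective) same (n , n≤ , map-walk w))

colour-1-independent : ∀ {G k π u v} → IsPackingColouring G k π → Adj G u v → u ≢ v → π u ≡ 1 → ¬ π v ≡ 1
colour-1-independent (_ , packed) e u≢v πu≡1 πv≡1 =
  packed _ _ u≢v (trans πu≡1 (sym πv≡1)) (1 , ≤-reflexive (sym πu≡1) , step e here)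

module PackingSearch (G : Graph) (_≟_ : DecidableEquality (V G))
                     (neighbours : (u : V G) → List (Σ (V G) (Adj G u))) where

  prepend : ∀ {u w v d} → Adj G u w → DistLe G w v d → DistLe G u v (suc d)
  prepend e (n , n≤d , p) = suc n , s≤s n≤d , step e p

  walk? : ∀ d u v → Maybe (DistLe G u v d)
  walk? d       u v with u ≟ v
  walk? d       u v | yes refl = just (0 , z≤n , here)
  walk? zero    u v | no _     = nothing
  walk? (suc d) u v | no _     =
    foldr _<∣>_ nothing (map (λ (w , e) → Maybe.map (prepend e) (walk? d w v)) (neighbours u))

  Clash : ℕ → V G → V G → Set
  Clash c u v = u ≢ v × DistLe G u v c

  clash? : ∀ c u v → Maybe (Clash c u v)
  clash? c u v with u ≟ v
  ... | yes _   = nothing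
  ... | no u≢v = Maybe.map (u≢v ,_) (walk? c u v)

  admits : List (V G × ℕ) → V G → ℕ → Bool
  admits asg v c = all (λ (u , c′) → not ((c′ ≡ᵇ c) ∧ is-just (clash? c u v))) asg

  completable : List (V G × ℕ) → List (V G × List ℕ) → Bool
  completable asg []              = true
  completable asg ((v , cs) ∷ vs) = any (λ c → admits asg v c ∧ completable ((v , c) ∷ asg) vs) cs

  Agrees : (V G → ℕ) → V G × ℕ → Set
  Agrees σ (u , c) = σ u ≡ c

  Offers : (V G → ℕ) → V G × List ℕ → Set
  Offers σ (v , cs) = σ v ∈ cs

  module _ {k} {σ : V G → ℕ} (σ-packing : IsPackingColouring G k σ) where

    no-clash : ∀ u v → T (not ((σ u ≡ᵇ σ v) ∧ is-just (clash? (σ v) u v)))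
    no-clash u v with σ u ≡ᵇ σ v in eq
    ... | false = tt
    ... | true with clash? (σ v) u v
    ...   | nothing = tt
    ...   | just (u≢v , u~v) = proj₂ σ-packing u v u≢v σu≡σv (subst (DistLe G u v) (sym σu≡σv) u~v)
      where
      σu≡σv : σ u ≡ σ v
      σu≡σv = ≡ᵇ⇒≡ (σ u) (σ v) (subst T (sym eq) tt)

    admits-colour : ∀ {asg} v → All (Agrees σ) asg → T (admits asg v (σ v))
    admits-colour v []          = tt
    admits-colour v (refl ∷ ok) = Equivalence.from T-∧ (no-clash _ v , admits-colour v ok)

    completable-sound : ∀ {asg} vs → All (Agrees σ) asg → All (Offers σ) vs → T (completable asg vs)
    completable-sound []              _  _               = tt
    completable-sound ((v , cs) ∷ vs) ok (σv∈cs ∷ σvs∈) =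
      Any.any⁺ _ (Any.map (λ { refl → Equivalence.from T-∧
        (admits-colour v ok , completable-sound vs (refl ∷ ok) σvs∈) }) σv∈cs)

    incompletable⇒¬Offers : ∀ vs → completable [] vs ≡ false → ¬ All (Offers σ) vs
    incompletable⇒¬Offers vs never offered = subst T never (completable-sound vs [] offered)

-- Layer 0 is a stretch of a ring; positions 0 … 5 are three consecutive rung blocks.
data WindowEdge : Fin 4 × Fin 6 → Fin 4 × Fin 6 → Set where
  ring : ∀ {p p′} → toℕ p′ ≡ suc (toℕ p) → WindowEdge (zero , p) (zero , p′)
  rung : ∀ {i p p′} k → toℕ p ≡ 2 * k → toℕ p′ ≡ suc (toℕ p) → WindowEdge (fsuc i , p) (fsuc i , p′)
  vert : ∀ {i i′ p} → toℕ i′ ≡ suc (toℕ i) → WindowEdge (i , p) (i′ , p)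

Window : Graph
Window = record { V = Fin 4 × Fin 6 ; Adj = λ x y → WindowEdge x y ⊎ WindowEdge y x }

Neighbours : V Window → Set
Neighbours v = List (Σ (V Window) (Adj Window v))

vertical : ∀ i p → Neighbours (i , p)
vertical 0F p = ((1F , p) , inj₁ (vert refl)) ∷ []
vertical 1F p = ((0F , p) , inj₂ (vert refl)) ∷ ((2F , p) , inj₁ (vert refl)) ∷ []
vertical 2F p = ((1F , p) , inj₂ (vert refl)) ∷ ((3F , p) , inj₁ (vert refl)) ∷ []
vertical 3F p = ((2F , p) , inj₂ (vert refl)) ∷ []

horizontal : ∀ i p → Neighbours (i , p)
horizontal 0F 0F = ((0F , 1F) , inj₁ (ring refl)) ∷ []
horizontal 0F 1F = ((0F , 0F) , inj₂ (ring refl)) ∷ ((0F , 2F) , inj₁ (ring refl)) ∷ []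
horizontal 0F 2F = ((0F , 1F) , inj₂ (ring refl)) ∷ ((0F , 3F) , inj₁ (ring refl)) ∷ []
horizontal 0F 3F = ((0F , 2F) , inj₂ (ring refl)) ∷ ((0F , 4F) , inj₁ (ring refl)) ∷ []
horizontal 0F 4F = ((0F , 3F) , inj₂ (ring refl)) ∷ ((0F , 5F) , inj₁ (ring refl)) ∷ []
horizontal 0F 5F = ((0F , 4F) , inj₂ (ring refl)) ∷ []
horizontal (fsuc i) 0F = ((fsuc i , 1F) , inj₁ (rung 0 refl refl)) ∷ []
horizontal (fsuc i) 1F = ((fsuc i , 0F) , inj₂ (rung 0 refl refl)) ∷ []
horizontal (fsuc i) 2F = ((fsuc i , 3F) , inj₁ (rung 1 refl refl)) ∷ []
horizontal (fsuc i) 3F = ((fsuc i , 2F) , inj₂ (rung 1 refl refl)) ∷ []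
horizontal (fsuc i) 4F = ((fsuc i , 5F) , inj₁ (rung 2 refl refl)) ∷ []
horizontal (fsuc i) 5F = ((fsuc i , 4F) , inj₂ (rung 2 refl refl)) ∷ []

open PackingSearch Window (≡-dec Fin._≟_ Fin._≟_) (λ (i , p) → vertical i p ++ horizontal i p)

colours : List ℕ
colours = 1 ∷ 2 ∷ 3 ∷ 4 ∷ 5 ∷ []

colours-but-1 : List ℕ
colours-but-1 = 2 ∷ 3 ∷ 4 ∷ 5 ∷ []

∈-colours : ∀ {n} → 1 ≤ n → n ≤ 5 → n ∈ colours
∈-colours {1} _ _ = here refl
∈-colours {2} _ _ = there (here refl)
∈-colours {3} _ _ = there (there (here refl))
∈-colours {4} _ _ = there (there (there (here refl)))
∈-colours {5} _ _ = there (there (there (there (here refl))))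
∈-colours {suc (suc (suc (suc (suc (suc _)))))} _ (s≤s (s≤s (s≤s (s≤s (s≤s ())))))

∈-colours-but-1 : ∀ {n} → n ≢ 1 → n ∈ colours → n ∈ colours-but-1
∈-colours-but-1 n≢1 (here n≡1) = ⊥-elim (n≢1 n≡1)
∈-colours-but-1 n≢1 (there n∈) = n∈

-- The order only affects how long the search takes.
search-order : List (V Window)
search-order =
  (1F , 3F) ∷ (1F , 2F) ∷ (2F , 3F) ∷ (2F , 2F) ∷ (3F , 3F) ∷ (3F , 2F) ∷ (0F , 4F) ∷ (0F , 1F) ∷
  (0F , 0F) ∷ (1F , 1F) ∷ (0F , 5F) ∷ (1F , 4F) ∷ (1F , 0F) ∷ (2F , 1F) ∷ (1F , 5F) ∷ (2F , 4F) ∷ []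

middle-not-1 : List (V Window × List ℕ)
middle-not-1 = ((0F , 2F) , colours-but-1) ∷ ((0F , 3F) , colours-but-1) ∷ map (_, colours) search-order

middle-not-1-incompletable : completable [] middle-not-1 ≡ false
middle-not-1-incompletable = refl

window-middle-coloured-1 : ∀ σ → IsPackingColouring Window 5 σ → σ (0F , 2F) ≡ 1 ⊎ σ (0F , 3F) ≡ 1
window-middle-coloured-1 σ σ-packing with σ (0F , 2F) ≟ 1 | σ (0F , 3F) ≟ 1
... | yes σ₂≡1 | _         = inj₁ σ₂≡1
... | no _     | yes σ₃≡1 = inj₂ σ₃≡1
... | no σ₂≢1  | no σ₃≢1  = ⊥-elim (incompletable⇒¬Offers σ-packing middle-not-1 middle-not-1-incompletable offered)
  where
  in-range : ∀ v → σ v ∈ colours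
  in-range v = let (1≤σv , σv≤5) = proj₁ σ-packing v in ∈-colours 1≤σv σv≤5

  offered : All (Offers σ) middle-not-1
  offered = ∈-colours-but-1 σ₂≢1 (in-range _) ∷ ∈-colours-but-1 σ₃≢1 (in-range _) ∷
            All.map⁺ (All.universal in-range search-order)

even-or-odd : ∀ n → ∃[ k ] (2 * k ≡ n ⊎ suc (2 * k) ≡ n)
even-or-odd zero = 0 , inj₁ refl
even-or-odd (suc n) with even-or-odd n
... | k , inj₁ refl = k , inj₂ refl
... | k , inj₂ refl = suc k , inj₁ (*-suc 2 k)

covered-across-blocks : ∀ {E O : ℕ → Set} → Decidable E → ∀ m →
                        (∀ k → E k ⊎ O k) → (∀ k → O k → ¬ E (suc k)) → (∀ k → E k → E (k + suc m)) →
                        ∀ k → O k ⊎ E (suc k)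
covered-across-blocks {E} E? m covered exclusive periodic k with E? (suc k)
... | yes e = inj₂ e
... | no ¬e = inj₁ ([ (λ e → ⊥-elim (never-even m (subst E shift (periodic k e)))) , id ]′ (covered k))
  where
  -- Without E (suc k), each later block is covered by O, which rules out E at the next one.
  never-even : ∀ i → ¬ E (i + suc k)
  never-even zero    = ¬e
  never-even (suc i) e = [ never-even i , (λ o → exclusive (i + suc k) o e) ]′ (covered (i + suc k))

  shift : k + suc m ≡ m + suc k
  shift = trans (+-comm k (suc m)) (sym (+-suc m k))

double-split : ∀ a d r b → 2 * (a + d * r) + b ≡ (2 * a + b) + d * (2 * r)
double-split = solve-∀

module Columns (r : ℕ) .{{_ : NonZero r}} where

  private
    N : ℕ
    N = 2 * r

    instance
      N-nonZero : NonZero N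
      N-nonZero = m*n≢0 2 r

  column : ℕ → Fin N
  column n = n mod N

  toℕ-column : ∀ n → toℕ (column n) ≡ n % N
  toℕ-column n = toℕ-fromℕ< (m%n<n n N)

  column-cong : ∀ {m n} → m % N ≡ n % N → column m ≡ column n
  column-cong {m} {n} eq = toℕ-injective (trans (toℕ-column m) (trans eq (sym (toℕ-column n))))

  column-toℕ : ∀ j → column (toℕ j) ≡ j
  column-toℕ j = toℕ-injective (trans (toℕ-column (toℕ j)) (m<n⇒m%n≡m (toℕ<n j)))

  column-periodic : ∀ n → column (n + N) ≡ column n
  column-periodic n = column-cong ([m+n]%n≡m%n n N)

  residue-suc : ∀ n → suc (n % N) ≡ suc n % N ⊎ (suc (n % N) ≡ N × suc n % N ≡ 0)
  residue-suc n = [ (λ 1+s<N → inj₁ (sym (trans suc-n% (m<n⇒m%n≡m 1+s<N))))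
                  , (λ 1+s≡N → inj₂ (1+s≡N , trans suc-n% (trans (cong (_% N) 1+s≡N) (n%n≡0 N)))) ]′
                  (m≤n⇒m<n∨m≡n (m%n<n n N))
    where
    suc-n% : suc n % N ≡ suc (n % N) % N
    suc-n% = trans (cong (_% N) (cong suc (m≡m%n+[m/n]*n n N))) ([m+kn]%n≡m%n (suc (n % N)) (n / N) N)

  column-CycSucc : ∀ n → CycSucc N (column n) (column (suc n))
  column-CycSucc n rewrite toℕ-column n | toℕ-column (suc n) = residue-suc n

  double-residue-< : ∀ m {b} → b < 2 → 2 * (m % r) + b < N
  double-residue-< m {b} b<2 = begin-strict
    2 * (m % r) + b   <⟨ +-monoʳ-< (2 * (m % r)) b<2 ⟩
    2 * (m % r) + 2   ≡⟨ +-comm (2 * (m % r)) 2 ⟩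
    2 + 2 * (m % r)   ≡⟨ *-suc 2 (m % r) ⟨
    2 * suc (m % r)   ≤⟨ *-monoʳ-≤ 2 (m%n<n m r) ⟩
    N                 ∎
    where open ≤-Reasoning

  double-residue : ∀ m {b} → b < 2 → (2 * m + b) % N ≡ 2 * (m % r) + b
  double-residue m {b} b<2 = begin
    (2 * m + b) % N                     ≡⟨ cong (_% N) (cong (λ x → 2 * x + b) (m≡m%n+[m/n]*n m r)) ⟩
    (2 * (m % r + m / r * r) + b) % N   ≡⟨ cong (_% N) (double-split (m % r) (m / r) r b) ⟩
    (2 * (m % r) + b + m / r * N) % N   ≡⟨ [m+kn]%n≡m%n (2 * (m % r) + b) (m / r) N ⟩
    (2 * (m % r) + b) % N               ≡⟨ m<n⇒m%n≡m (double-residue-< m b<2) ⟩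
    2 * (m % r) + b                     ∎
    where open ≡-Reasoning

  toℕ-column-even : ∀ m → toℕ (column (2 * m + 0)) ≡ 2 * (m % r)
  toℕ-column-even m = trans (toℕ-column _) (trans (double-residue m (s≤s z≤n)) (+-identityʳ _))

  toℕ-column-odd : ∀ m → toℕ (column (2 * m + 1)) ≡ suc (toℕ (column (2 * m + 0)))
  toℕ-column-odd m = trans (toℕ-column _) (trans (double-residue m (s≤s (s≤s z≤n)))
                       (trans (+-comm _ 1) (cong suc (sym (toℕ-column-even m)))))

  residue-+ : ∀ z {t} → t < N → (z + t) % N ≡ (z % N + t) % N
  residue-+ z {t} t<N = trans (%-distribˡ-+ z t N) (cong (λ x → (z % N + x) % N) (m<n⇒m%n≡m t<N))

  residue-shift : ∀ z {t} → 0 < t → t < N → (z + t) % N ≢ z % N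
  residue-shift z {t} 0<t t<N eq with z % N + t <? N
  ... | yes s+t<N = <-irrefl (sym t≡0) 0<t
    where
    t≡0 : t ≡ 0
    t≡0 = +-cancelˡ-≡ (z % N) t 0
            (trans (sym (trans (residue-+ z t<N) (m<n⇒m%n≡m s+t<N))) (trans eq (sym (+-identityʳ _))))
  ... | no s+t≮N = <-irrefl t≡N t<N
    where
    s = z % N
    u = s + t ∸ N
    N+u≡s+t : N + u ≡ s + t
    N+u≡s+t = m+[n∸m]≡n (≮⇒≥ s+t≮N)
    u<N : u < N
    u<N = +-cancelˡ-< N u N (subst (_< N + N) (sym N+u≡s+t) (+-mono-< (m%n<n z N) t<N))
    u≡s : u ≡ s
    u≡s = begin
      u                ≡⟨ m<n⇒m%n≡m u<N ⟨
      u % N            ≡⟨ [m+n]%n≡m%n u N ⟨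
      (u + N) % N      ≡⟨ cong (_% N) (trans (+-comm u N) N+u≡s+t) ⟩
      (s + t) % N      ≡⟨ residue-+ z t<N ⟨
      (z + t) % N      ≡⟨ eq ⟩
      s                ∎
      where open ≡-Reasoning
    t≡N : t ≡ N
    t≡N = +-cancelˡ-≡ s t N (trans (sym N+u≡s+t) (trans (cong (N +_) u≡s) (+-comm N s)))

  residue-apart : ∀ a {x y} → x < y → y < N → (a + y) % N ≢ (a + x) % N
  residue-apart a {x} {y} x<y y<N eq = residue-shift (a + x) (m<n⇒0<n∸m x<y) (≤-<-trans (m∸n≤m y x) y<N)
    (trans (cong (_% N) (trans (+-assoc a x (y ∸ x)) (cong (a +_) (m+[n∸m]≡n (<⇒≤ x<y))))) eq)

  residue-injective : ∀ a {x y} → x < N → y < N → (a + x) % N ≡ (a + y) % N → x ≡ y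
  residue-injective a {x} {y} x<N y<N eq with <-cmp x y
  ... | tri< x<y _ _ = ⊥-elim (residue-apart a x<y y<N (sym eq))
  ... | tri≈ _ x≡y _ = x≡y
  ... | tri> _ _ y<x = ⊥-elim (residue-apart a y<x x<N eq)

  column-injective : ∀ a {x y} → x < N → y < N → column (a + x) ≡ column (a + y) → x ≡ y
  column-injective a {x} {y} x<N y<N eq = residue-injective a x<N y<N
    (trans (sym (toℕ-column (a + x))) (trans (cong toℕ eq) (toℕ-column (a + y))))

  column-suc-≢ : ∀ n → column n ≢ column (suc n)
  column-suc-≢ n eq = 0≢1+n (column-injective n {0} {1} 0<N 1<N
    (trans (cong column (+-identityʳ n)) (trans eq (cong column (+-comm 1 n)))))
    where
    1<N : 1 < N
    1<N = *-monoʳ-≤ 2 (>-nonZero⁻¹ r)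
    0<N : 0 < N
    0<N = <-trans z<s 1<N

CycSucc-functional : ∀ {n} {j j′ j″ : Fin n} → CycSucc n j j′ → CycSucc n j j″ → j′ ≡ j″
CycSucc-functional (inj₁ e′)      (inj₁ e″)      = toℕ-injective (trans (sym e′) e″)
CycSucc-functional (inj₁ e′)      (inj₂ (e″ , _)) = ⊥-elim (<-irrefl (trans (sym e′) e″) (toℕ<n _))
CycSucc-functional (inj₂ (e′ , _)) (inj₁ e″)      = ⊥-elim (<-irrefl (trans (sym e″) e′) (toℕ<n _))
CycSucc-functional (inj₂ (_ , e′)) (inj₂ (_ , e″)) = toℕ-injective (trans e′ (sym e″))

module Reflection (ℓ r : ℕ) where

  reflect : HV ℓ r → HV ℓ r
  reflect (i , j) = opposite i , j

  toℕ-opposite : ∀ {i : Fin (suc (suc ℓ))} → toℕ i ≤ ℓ → toℕ (opposite i) ≡ suc (ℓ ∸ toℕ i)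
  toℕ-opposite {i} i≤ℓ = trans (opposite-prop i) (+-∸-assoc 1 i≤ℓ)

  reflect-edge : ∀ {u v} → HEdge ℓ r u v → Adj (H ℓ r) (reflect u) (reflect v)
  reflect-edge (outer i j j′ (inj₁ i≡0) j→j′) =
    inj₁ (outer (opposite i) j j′ (inj₂ (trans (opposite-prop i) (cong (suc ℓ ∸_) i≡0))) j→j′)
  reflect-edge (outer i j j′ (inj₂ i≡1+ℓ) j→j′) =
    inj₁ (outer (opposite i) j j′
      (inj₁ (trans (opposite-prop i) (trans (cong (suc ℓ ∸_) i≡1+ℓ) (n∸n≡0 (suc ℓ))))) j→j′)
  reflect-edge (rung i j j′ k 1≤i i≤ℓ j≡2k j′≡1+j) =
    inj₁ (rung (opposite i) j j′ k (subst (1 ≤_) (sym (toℕ-opposite i≤ℓ)) (s≤s z≤n))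
           (subst (_≤ ℓ) (sym (opposite-prop i)) (∸-monoʳ-≤ (suc ℓ) 1≤i)) j≡2k j′≡1+j)
  reflect-edge (vert i i′ j i′≡1+i) =
    inj₂ (vert (opposite i′) (opposite i) j (trans (toℕ-opposite i≤ℓ) (cong suc (sym opposite-i′))))
    where
    i≤ℓ : toℕ i ≤ ℓ
    i≤ℓ = ≤-pred (subst (_≤ suc ℓ) i′≡1+i (≤-pred (toℕ<n i′)))
    opposite-i′ : toℕ (opposite i′) ≡ ℓ ∸ toℕ i
    opposite-i′ = trans (opposite-prop i′) (cong (suc ℓ ∸_) i′≡1+i)

  reflect-hom : Homomorphism (H ℓ r) (H ℓ r) reflect
  reflect-hom = [ reflect-edge , swap ∘ reflect-edge ]′

  reflect-involutive : ∀ v → reflect (reflect v) ≡ v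
  reflect-involutive (i , j) = cong (_, j) (opposite-involutive i)

  reflect-injective : Injective _≡_ _≡_ reflect
  reflect-injective {u} {v} eq =
    trans (sym (reflect-involutive u)) (trans (cong reflect eq) (reflect-involutive v))

even-offset : ∀ q k → 2 * q + 2 * k ≡ 2 * (q + k) + 0
even-offset = solve-∀

odd-offset : ∀ q k → 2 * q + suc (2 * k) ≡ 2 * (q + k) + 1
odd-offset = solve-∀

module WindowEmbedding (ℓ r : ℕ) .{{_ : NonZero r}} (3≤ℓ : 3 ≤ ℓ) (3≤r : 3 ≤ r) (q : ℕ) where
  open Columns r

  4≤2+ℓ : 4 ≤ suc (suc ℓ)
  4≤2+ℓ = s≤s (s≤s (≤-trans (n≤1+n 2) 3≤ℓ))

  -- r ≥ 3 keeps the six columns 2q, …, 2q + 5 distinct modulo 2r.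
  embed : V Window → HV ℓ r
  embed (i , p) = inject≤ i 4≤2+ℓ , column (2 * q + toℕ p)

  embed-edge : ∀ {x y} → WindowEdge x y → HEdge ℓ r (embed x) (embed y)
  embed-edge (ring {p} {p′} p′≡1+p) = outer _ _ _ (inj₁ refl)
    (subst (CycSucc (2 * r) _) (cong column (sym (trans (cong (2 * q +_) p′≡1+p) (+-suc (2 * q) (toℕ p)))))
      (column-CycSucc (2 * q + toℕ p)))
  embed-edge (rung {i} {p} {p′} k p≡2k p′≡1+p) = rung _ _ _ ((q + k) % r) (s≤s z≤n) inner even odd
    where
    inner : suc (toℕ (inject≤ i _)) ≤ ℓ
    inner = subst (λ x → suc x ≤ ℓ) (sym (toℕ-inject≤ i _)) (≤-trans (toℕ<n i) 3≤ℓ)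
    left : 2 * q + toℕ p ≡ 2 * (q + k) + 0
    left = trans (cong (2 * q +_) p≡2k) (even-offset q k)
    right : 2 * q + toℕ p′ ≡ 2 * (q + k) + 1
    right = trans (cong (2 * q +_) (trans p′≡1+p (cong suc p≡2k))) (odd-offset q k)
    even : toℕ (column (2 * q + toℕ p)) ≡ 2 * ((q + k) % r)
    even = trans (cong (toℕ ∘ column) left) (toℕ-column-even (q + k))
    odd : toℕ (column (2 * q + toℕ p′)) ≡ suc (toℕ (column (2 * q + toℕ p)))
    odd = trans (cong (toℕ ∘ column) right)
            (trans (toℕ-column-odd (q + k)) (cong (suc ∘ toℕ ∘ column) (sym left)))
  embed-edge (vert {i} {i′} i′≡1+i) =
    vert _ _ _ (trans (toℕ-inject≤ i′ _) (trans i′≡1+i (cong suc (sym (toℕ-inject≤ i _)))))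

  embed-hom : Homomorphism Window (H ℓ r) embed
  embed-hom = Sum.map embed-edge embed-edge

  in-window : ∀ (p : Fin 6) → toℕ p < 2 * r
  in-window p = ≤-trans (toℕ<n p) (*-monoʳ-≤ 2 3≤r)

  embed-injective : Injective _≡_ _≡_ embed
  embed-injective {i , p} {i′ , p′} eq = ×-≡,≡→≡
    ( inject≤-injective _ _ i i′ (proj₁ (,-injective eq))
    , toℕ-injective (column-injective (2 * q) (in-window p) (in-window p′) (proj₂ (,-injective eq))))

wrap-even : ∀ k r′ → 2 * (k + r′) + 2 ≡ 2 * k + 2 * suc r′
wrap-even = solve-∀

wrap-odd : ∀ k r′ → 2 * (k + r′) + 3 ≡ suc (2 * k) + 2 * suc r′
wrap-odd = solve-∀

module OuterRing (ℓ r′ : ℕ) (3≤ℓ : 3 ≤ ℓ) (3≤r : 3 ≤ suc r′)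
                 (π : HV ℓ (suc r′) → ℕ) (π-packing : IsPackingColouring (H ℓ (suc r′)) 5 π) where
  open Columns (suc r′)

  Coloured-1 : ℕ → Set
  Coloured-1 n = π (zero , column n) ≡ 1

  block-coloured-1 : ∀ k → Coloured-1 (2 * k) ⊎ Coloured-1 (suc (2 * k))
  block-coloured-1 k =
    Sum.map (subst (λ j → π (zero , j) ≡ 1) (wrap (2 * k) (wrap-even k r′)))
            (subst (λ j → π (zero , j) ≡ 1) (wrap (suc (2 * k)) (wrap-odd k r′)))
            (window-middle-coloured-1 (π ∘ embed) (packing-pullback embed-hom embed-injective π-packing))
    where
    -- The window starts at block k + r′ ≡ k − 1, so its middle block is block k.
    open WindowEmbedding ℓ (suc r′) 3≤ℓ 3≤r (k + r′)
    wrap : ∀ {m} n → m ≡ n + 2 * suc r′ → column m ≡ column n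
    wrap n eq = trans (cong column eq) (column-periodic n)

  odd-excludes-next-even : ∀ k → Coloured-1 (suc (2 * k)) → ¬ Coloured-1 (2 * suc k)
  odd-excludes-next-even k = colour-1-independent π-packing adjacent (column-suc-≢ (suc (2 * k)) ∘ same-column)
    where
    next : column (suc (suc (2 * k))) ≡ column (2 * suc k)
    next = cong column (sym (*-suc 2 k))
    adjacent : Adj (H ℓ (suc r′)) (zero , column (suc (2 * k))) (zero , column (2 * suc k))
    adjacent = inj₁ (outer zero _ _ (inj₁ refl) (subst (CycSucc _ _) next (column-CycSucc (suc (2 * k)))))
    same-column : (zero , column (suc (2 * k))) ≡ (zero , column (2 * suc k)) →
                  column (suc (2 * k)) ≡ column (suc (suc (2 * k)))
    same-column eq = trans (proj₂ (,-injective eq)) (sym next)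

  even-periodic : ∀ k → Coloured-1 (2 * k) → Coloured-1 (2 * (k + suc r′))
  even-periodic k = subst (λ j → π (zero , j) ≡ 1)
                 (sym (trans (cong column (*-distribˡ-+ 2 k (suc r′))) (column-periodic (2 * k))))

  column-edge-coloured-1 : ∀ n → Coloured-1 n ⊎ Coloured-1 (suc n)
  column-edge-coloured-1 n with even-or-odd n
  ... | k , inj₁ refl = block-coloured-1 k
  ... | k , inj₂ refl = Sum.map₂ (subst Coloured-1 (*-suc 2 k))
    (covered-across-blocks {E = λ k → Coloured-1 (2 * k)} {O = λ k → Coloured-1 (suc (2 * k))}
       (λ k → π (zero , column (2 * k)) ≟ 1) r′ block-coloured-1 odd-excludes-next-even even-periodic k)

  ring-edge-coloured-1 : ∀ {j j′} → CycSucc (2 * suc r′) j j′ → π (zero , j) ≡ 1 ⊎ π (zero , j′) ≡ 1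
  ring-edge-coloured-1 {j} {j′} j→j′ =
    Sum.map (subst (λ x → π (zero , x) ≡ 1) (column-toℕ j))
            (subst (λ x → π (zero , x) ≡ 1) successor)
            (column-edge-coloured-1 (toℕ j))
    where
    successor : column (suc (toℕ j)) ≡ j′
    successor = CycSucc-functional
      (subst (λ x → CycSucc _ x (column (suc (toℕ j)))) (column-toℕ j) (column-CycSucc (toℕ j))) j→j′

lemma13 : (ℓ r : ℕ) → 3 ≤ ℓ → 3 ≤ r →
    ChiRhoLe (H ℓ r) 5 →
    (π : HV ℓ r → ℕ) → IsPackingColouring (H ℓ r) 5 π →
    (j j' : Fin (2 * r)) → CycSucc (2 * r) j j' →
    (π (zero , j) ≡ 1 ⊎ π (zero , j') ≡ 1) ×
    (π (fromℕ (suc ℓ) , j) ≡ 1 ⊎ π (fromℕ (suc ℓ) , j') ≡ 1)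
lemma13 ℓ zero     _   ()
lemma13 ℓ (suc r′) 3≤ℓ 3≤r _ π π-packing j j′ j→j′ =
  bottom.ring-edge-coloured-1 j→j′ , top.ring-edge-coloured-1 j→j′
  where
  open Reflection ℓ (suc r′)
  module bottom = OuterRing ℓ r′ 3≤ℓ 3≤r π π-packing
  module top = OuterRing ℓ r′ 3≤ℓ 3≤r (π ∘ reflect) (packing-pullback reflect-hom reflect-injective π-packing)
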